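{- The following irreducible $\Re$-modules are mutually non-isomorphic: $R_{\frac{n-1}{2}}(-\frac14,-\frac14,-\frac14)$ for all odd integers $n\ge1$; $R_{\frac{n-2}{4}}(\frac{n-2}{8},\frac{n-2}{8},\frac{n-6}{8})$, $R_{\frac{n-2}{4}}(\frac{n-2}{8},\frac{n-6}{8},\frac{n-2}{8})$, $R_{\frac{n-2}{4}}(\frac{n-6}{8},\frac{n-2}{8},\frac{n-2}{8})$ for all integers $n\ge2$ with $n\equiv2\pmod4$; $R_{\frac{n-6}{4}}(\frac{n-2}{8},\frac{n-2}{8},\frac{n-2}{8})$ for all integers $n\ge6$ with $n\equiv2\pmod4$; $R_{\frac n4-1}(\frac{n-4}{8},\frac{n-4}{8},\frac n8)$, $R_{\frac n4-1}(\frac{n-4}{8},\frac n8,\frac{n-4}{8})$, $R_{\frac n4-1}(\frac n8,\frac{n-4}{8},\frac{n-4}{8})$ for all integers $n\ge4$ with $n\equiv0\pmod4$; $R_{\frac n4}(\frac{n-4}{8},\frac{n-4}{8},\frac{n-4}{8})$ for all integers $n\ge0$ with $n\equiv0\pmod4$.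
   Context: The universal Racah algebra $\Re$ is the $\mathbb C$-algebra generated by $A,B,C,\Delta$ subject to $[A,B]=[B,C]=[C,A]=2\Delta$ ($[x,y]=xy-yx$) and the requirement that each of $[A,\Delta]+AC-BA$, $[B,\Delta]+BA-CB$, $[C,\Delta]+CB-AC$ is central; $\delta=A+B+C$. For $a,b,c\in\mathbb C$, $d\in\mathbb N$, $R_d(a,b,c)$ is the $(d+1)$-dimensional $\Re$-module having a basis in which $A$ is lower bidiagonal with diagonal $\theta_i=(a+\frac d2-i)(a+\frac d2-i+1)$ ($0\le i\le d$) and subdiagonal entries $1$, $B$ is upper bidiagonal with diagonal $\theta_i^*=(b+\frac d2-i)(b+\frac d2-i+1)$ and superdiagonal $\varphi_i=i(i-d-1)(a+b+c+\frac d2-i+2)(a+b-c+\frac d2-i+1)$ ($1\le i\le d$), and $\delta$ acts as $\frac d2(\frac d2+1)+a(a+1)+b(b+1)+c(c+1)$. (Each module in the list is irreducible.) -}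

module Defs where

open import Level using (Level; _⊔_)
open import Data.Nat as ℕ using (ℕ; zero; suc)
open import Data.Fin using (Fin; toℕ)
open import Data.Integer using (ℤ; +_)
open import Data.Rational as ℚ using (ℚ; _/_; _+_; _-_; _*_; -_)
open import Data.Product using (Σ; _×_; ∃; _,_; proj₁; proj₂)
open import Relation.Nullary using (¬_; does)
open import Relation.Binary.PropositionalEquality using (_≡_)
open import Data.Bool using (if_then_else_)
open import Algebra.Bundles using (CommutativeRing; RawRing)
open import Algebra.Morphism.Structures using (IsRingHomomorphism)

-- Ground field: a field K together with a ring homomorphism ℚ → K
-- (i.e. a field of characteristic 0, e.g. ℂ).  The paper works over ℂ.

IsField : ∀ {c ℓ} → CommutativeRing c ℓ → Set (c ⊔ ℓ)
IsField K = ¬ (1# ≈ 0#) × (∀ x → ¬ (x ≈ 0#) → Σ Carrier λ y → x *ₖ y ≈ 1#)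
  where open CommutativeRing K using (Carrier; _≈_; 0#; 1#) renaming (_*_ to _*ₖ_)

record ℚField (c ℓ : Level) : Set (Level.suc (c ⊔ ℓ)) where
  field
    ring    : CommutativeRing c ℓ
    isField : IsField ring
    ι       : ℚ → CommutativeRing.Carrier ring
    ι-hom   : IsRingHomomorphism ℚ.+-*-rawRing (CommutativeRing.rawRing ring) ι

Matℚ : ℕ → ℕ → Set
Matℚ r c = Fin r → Fin c → ℚ

sumℚ : ∀ {n} → (Fin n → ℚ) → ℚ
sumℚ {zero}  f = ℚ.0ℚ
sumℚ {suc n} f = f Fin.zero + sumℚ (λ i → f (Fin.suc i))
  where import Data.Fin as Fin

_·ℚ_ : ∀ {r m c} → Matℚ r m → Matℚ m c → Matℚ r c
(X ·ℚ Y) i j = sumℚ (λ k → X i k * Y k j)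

ℕ→ℚ : ℕ → ℚ
ℕ→ℚ n = (+ n) / 1

idℚ : ∀ {n} → Matℚ n n
idℚ i j = if does (toℕ i ℕ.≟ toℕ j) then ℚ.1ℚ else ℚ.0ℚ

-- The module R_d(a,b,c), given by the action of the generators
-- A, B, C, Δ of the universal Racah algebra on the basis v₀ … v_d.
-- A is lower bidiagonal (diag θ_i, subdiagonal 1), B is upper
-- bidiagonal (diag θ*_i, superdiagonal φ_i at position (i-1,i)),
-- δ = A + B + C acts as the scalar given in the paper, so
-- C = δ·I − A − B, and Δ = (AB − BA)/2 from [A,B] = 2Δ.

half : ℚ
half = (+ 1) / 2

module R (d : ℕ) (a b c : ℚ) where

  D : ℚ
  D = ℕ→ℚ d * half

  θ : ℕ → ℚ
  θ i = (a + D - ℕ→ℚ i) * (a + D - ℕ→ℚ i + ℚ.1ℚ)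

  θ* : ℕ → ℚ
  θ* i = (b + D - ℕ→ℚ i) * (b + D - ℕ→ℚ i + ℚ.1ℚ)

  φ : ℕ → ℚ
  φ i = ℕ→ℚ i * (ℕ→ℚ i - ℕ→ℚ d - ℚ.1ℚ)
        * (a + b + c + D - ℕ→ℚ i + (+ 2) / 1)
        * (a + b - c + D - ℕ→ℚ i + ℚ.1ℚ)

  δ : ℚ
  δ = D * (D + ℚ.1ℚ) + a * (a + ℚ.1ℚ) + b * (b + ℚ.1ℚ) + c * (c + ℚ.1ℚ)

  Aₘ : Matℚ (suc d) (suc d)
  Aₘ i j = if does (toℕ i ℕ.≟ toℕ j) then θ (toℕ i)
           else if does (toℕ i ℕ.≟ suc (toℕ j)) then ℚ.1ℚ
           else ℚ.0ℚ

  Bₘ : Matℚ (suc d) (suc d)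
  Bₘ i j = if does (toℕ i ℕ.≟ toℕ j) then θ* (toℕ i)
           else if does (toℕ j ℕ.≟ suc (toℕ i)) then φ (toℕ j)
           else ℚ.0ℚ

  Cₘ : Matℚ (suc d) (suc d)
  Cₘ i j = δ * idℚ i j - Aₘ i j - Bₘ i j

  Δₘ : Matℚ (suc d) (suc d)
  Δₘ i j = half * ((Aₘ ·ℚ Bₘ) i j - (Bₘ ·ℚ Aₘ) i j)

module OverK {k ℓ} (F : ℚField k ℓ) where
  open ℚField F
  open CommutativeRing ring using (Carrier; _≈_; 0#; 1#) renaming (_*_ to _*ₖ_; _+_ to _+ₖ_)

  Mat : ℕ → ℕ → Set k
  Mat r s = Fin r → Fin s → Carrier

  sumK : ∀ {n} → (Fin n → Carrier) → Carrier
  sumK {zero}  f = 0#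
  sumK {suc n} f = f Fin.zero +ₖ sumK (λ i → f (Fin.suc i))
    where import Data.Fin as Fin

  _·_ : ∀ {r m s} → Mat r m → Mat m s → Mat r s
  (X · Y) i j = sumK (λ k → X i k *ₖ Y k j)

  _≈ₘ_ : ∀ {r s} → Mat r s → Mat r s → Set ℓ
  X ≈ₘ Y = ∀ i j → X i j ≈ Y i j

  I : ∀ {n} → Mat n n
  I i j = if does (toℕ i ℕ.≟ toℕ j) then 1# else 0#

  ιₘ : ∀ {r s} → Matℚ r s → Mat r s
  ιₘ X i j = ι (X i j)

  Isomorphic : (d : ℕ) (a b c : ℚ) (d′ : ℕ) (a′ b′ c′ : ℚ) → Set (k ⊔ ℓ)
  Isomorphic d a b c d′ a′ b′ c′ =
    Σ (Mat (suc d′) (suc d)) λ P → Σ (Mat (suc d) (suc d′)) λ Q →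
      ((P · Q) ≈ₘ I) × ((Q · P) ≈ₘ I) ×
      ((P · ιₘ R₁.Aₘ) ≈ₘ (ιₘ R₂.Aₘ · P)) ×
      ((P · ιₘ R₁.Bₘ) ≈ₘ (ιₘ R₂.Bₘ · P)) ×
      ((P · ιₘ R₁.Cₘ) ≈ₘ (ιₘ R₂.Cₘ · P)) ×
      ((P · ιₘ R₁.Δₘ) ≈ₘ (ιₘ R₂.Δₘ · P))
    where
      module R₁ = R d a b c
      module R₂ = R d′ a′ b′ c′

-- The list of modules in Proposition 7.7.  Each family is indexed by
-- m : ℕ, with n expressed through m:
--   fam1 m      : n = 2m+1   (odd n ≥ 1)
--   fam2 k m    : n = 4m+2   (n ≥ 2, n ≡ 2 mod 4), k = position of (n-6)/8
--   fam3 m      : n = 4m+6   (n ≥ 6, n ≡ 2 mod 4)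
--   fam4 k m    : n = 4m+4   (n ≥ 4, n ≡ 0 mod 4), k = position of n/8
--   fam5 m      : n = 4m     (n ≥ 0, n ≡ 0 mod 4)

data Pos : Set where
  first second third : Pos

data Label : Set where
  fam1 : ℕ → Label
  fam2 : Pos → ℕ → Label
  fam3 : ℕ → Label
  fam4 : Pos → ℕ → Label
  fam5 : ℕ → Label

place : Pos → ℚ → ℚ → ℚ × ℚ × ℚ
place first  x y = x , y , y
place second x y = y , x , y
place third  x y = y , y , x

record Params : Set where
  constructor params
  field
    dim : ℕ
    pa pb pc : ℚ

nℚ : ℕ → ℚ
nℚ = ℕ→ℚ

over8 : ℚ → ℚ
over8 x = x * ((+ 1) / 8)

paramsOf : Label → Params
paramsOf (fam1 m) = params m (- ((+ 1) / 4)) (- ((+ 1) / 4)) (- ((+ 1) / 4))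
paramsOf (fam2 k m) = let n = nℚ (4 ℕ.* m ℕ.+ 2)
                          t = place k (over8 (n - (+ 6) / 1)) (over8 (n - (+ 2) / 1))
                      in params m (proj₁ t) (proj₁ (proj₂ t)) (proj₂ (proj₂ t))
paramsOf (fam3 m) = let n = nℚ (4 ℕ.* m ℕ.+ 6)
                        x = over8 (n - (+ 2) / 1)
                    in params m x x x
paramsOf (fam4 k m) = let n = nℚ (4 ℕ.* m ℕ.+ 4)
                          t = place k (over8 n) (over8 (n - (+ 4) / 1))
                      in params m (proj₁ t) (proj₁ (proj₂ t)) (proj₂ (proj₂ t))
paramsOf (fam5 m) = let n = nℚ (4 ℕ.* m)
                        x = over8 (n - (+ 4) / 1)
                    in params m x x x

module _ {c ℓ} (F : ℚField c ℓ) where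
  LabelIso : Label → Label → Set (c ⊔ ℓ)
  LabelIso l l′ = OverK.Isomorphic F (Params.dim p) (Params.pa p) (Params.pb p) (Params.pc p)
                                     (Params.dim p′) (Params.pa p′) (Params.pb p′) (Params.pc p′)
    where p = paramsOf l
          p′ = paramsOf l′

{-# OPTIONS --safe #-}
-- An isomorphism R_d(a,b,c) ≅ R_d′(a′,b′,c′) is an invertible matrix P with
-- P A = A′ P, P B = B′ P, P C = C′ P, so the dimensions agree (trace of the
-- identity) and tr A = tr A′, tr B = tr B′, tr C = tr C′; these traces are
-- rational, and the embedding ℚ → K is injective. The diagonal of A is
-- θ_i = x_i (x_i + 1) with x_i = a + d/2 - i, and Σ_i (d/2 - i) = 0, so
-- tr A = (d+1) a(a+1) + E_d with E_d independent of a; likewise for B, and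
-- tr A + tr B + tr C = (d+1) δ. Hence d and the Casimir values a(a+1),
-- b(b+1), c(c+1) are invariants, and so is |4a + 2| since
-- (4a + 2)² = 16 a(a+1) + 4. For a listed module of dimension m + 1 every
-- parameter has |4x + 2| ∈ {1, 2m, 2m + 2, 2m + 4}, and these triples tell the
-- listed modules of equal dimension apart.
module Submission where

open import Defs
open import Level using (Level)
open import Relation.Nullary using (¬_; yes; no; contradiction)
open import Relation.Binary.PropositionalEquality using (_≢_)

import Data.Rational.Properties as ℚP
open import Algebra.Bundles using (CommutativeRing; Ring)
open import Algebra.Morphism.Structures using (IsRingHomomorphism)
import Algebra.Properties.Semiring.Sum
open import Algebra.Properties.Semiring.Sum (Ring.semiring ℚP.+-*-ring)
  using (sum; sum-cong-≗; ∑-distrib-+; *-distribˡ-sum; sum-init-last)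
open import Algebra.Properties.Group ℚP.+-0-group
  using (x∙y⁻¹≈ε⇒x≈y) renaming (∙-cancelˡ to +-cancelˡ; ∙-cancelʳ to +-cancelʳ)
open import Data.Bool using (true)
open import Data.Bool.Properties using (T-≡)
open import Data.Empty using (⊥-elim)
open import Data.Fin using (Fin; toℕ; inject₁; fromℕ) renaming (zero to fzero; suc to fsuc)
open import Data.Fin.Properties using (toℕ-inject₁; toℕ-fromℕ)
import Data.Integer as ℤ
import Data.Integer.Properties as ℤP
open import Data.Maybe using (Maybe; just; nothing)
open import Data.Maybe.Properties using (just-injective)
open import Data.Nat as ℕ using (ℕ; zero; suc)
open import Data.Nat.Coprimality using (1-coprimeTo) renaming (sym to coprime-sym)
import Data.Nat.Properties as ℕP
open import Data.Nat.Tactic.RingSolver using (solve-∀)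
open import Data.Product using (_×_; _,_; proj₁)
open import Data.Rational as ℚ using (ℚ; 0ℚ; 1ℚ; 1/_)
open import Data.Rational.Solver using (module +-*-Solver)
open import Function using (_∘_; Equivalence)
open import Relation.Binary.Definitions using (tri<; tri≈; tri>)
open import Relation.Binary.PropositionalEquality as ≡ using (_≡_)
import Relation.Binary.Reasoning.Setoid

module Invariants where
  open import Data.Rational using (mkℚ; _/_; _+_; _-_; _*_)
  open ≡ using (refl; sym; trans; cong; cong₂; module ≡-Reasoning)
  open +-*-Solver
  open ≡-Reasoning

  private
    ℕ→ℚ≡mkℚ : ∀ n → ℕ→ℚ n ≡ mkℚ (ℤ.+ n) 0 (coprime-sym (1-coprimeTo n))
    ℕ→ℚ≡mkℚ n = ℚP.normalize-coprime (coprime-sym (1-coprimeTo n))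

  ℕ→ℚ-injective : ∀ {m n} → ℕ→ℚ m ≡ ℕ→ℚ n → m ≡ n
  ℕ→ℚ-injective {m} {n} e = ℤP.+-injective (cong ℚ.↥_ (trans (sym (ℕ→ℚ≡mkℚ m)) (trans e (ℕ→ℚ≡mkℚ n))))

  ℕ→ℚ-homo-+ : ∀ m n → ℕ→ℚ (m ℕ.+ n) ≡ ℕ→ℚ m + ℕ→ℚ n
  ℕ→ℚ-homo-+ m n rewrite ℕ→ℚ≡mkℚ m | ℕ→ℚ≡mkℚ n =
    cong (_/ 1) (cong₂ ℤ._+_ (sym (ℤP.*-identityʳ (ℤ.+ m))) (sym (ℤP.*-identityʳ (ℤ.+ n))))

  ℕ→ℚ-homo-* : ∀ m n → ℕ→ℚ (m ℕ.* n) ≡ ℕ→ℚ m * ℕ→ℚ n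
  ℕ→ℚ-homo-* m n rewrite ℕ→ℚ≡mkℚ m | ℕ→ℚ≡mkℚ n = cong (_/ 1) (ℤP.pos-* m n)

  ℕ→ℚ-suc : ∀ n → ℕ→ℚ (suc n) ≡ 1ℚ + ℕ→ℚ n
  ℕ→ℚ-suc = ℕ→ℚ-homo-+ 1

  ℕ→ℚ-suc≢0 : ∀ n → ℕ→ℚ (suc n) ≢ 0ℚ
  ℕ→ℚ-suc≢0 n e = ℕP.1+n≢0 (ℕ→ℚ-injective {suc n} {0} e)

  *-cancelˡ-≡ : ∀ p {x y} → p ≢ 0ℚ → p * x ≡ p * y → x ≡ y
  *-cancelˡ-≡ p {x} {y} p≢0 e = trans (sym (1/p*p* x)) (trans (cong (1/ p *_) e) (1/p*p* y))
    where
    instance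
      p-nonZero : ℚ.NonZero p
      p-nonZero = ℚ.≢-nonZero p≢0
    1/p*p* : ∀ z → 1/ p * (p * z) ≡ z
    1/p*p* z = begin
      1/ p * (p * z) ≡⟨ ℚP.*-assoc (1/ p) p z ⟨
      1/ p * p * z   ≡⟨ cong (_* z) (ℚP.*-inverseˡ p) ⟩
      1ℚ * z         ≡⟨ ℚP.*-identityˡ z ⟩
      z              ∎

  sum-const : ∀ n x → sum {n} (λ _ → x) ≡ ℕ→ℚ n * x
  sum-const zero    x = sym (ℚP.*-zeroˡ x)
  sum-const (suc n) x = begin
    x + sum {n} (λ _ → x)   ≡⟨ cong (x +_) (sum-const n x) ⟩
    x + ℕ→ℚ n * x           ≡⟨ solve 2 (λ x N → x :+ N :* x := (con 1ℚ :+ N) :* x) refl x (ℕ→ℚ n) ⟩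
    (1ℚ + ℕ→ℚ n) * x        ≡⟨ cong (_* x) (ℕ→ℚ-suc n) ⟨
    ℕ→ℚ (suc n) * x         ∎

  ∑-toℕ : ∀ n → sum {n} (λ i → ℕ→ℚ (toℕ i)) * ℕ→ℚ 2 + ℕ→ℚ n ≡ ℕ→ℚ n * ℕ→ℚ n
  ∑-toℕ zero    = refl
  ∑-toℕ (suc n) = begin
    sum {suc n} f * ℕ→ℚ 2 + ℕ→ℚ (suc n)
      ≡⟨ cong (λ s → s * ℕ→ℚ 2 + ℕ→ℚ (suc n)) (sum-init-last f) ⟩
    (sum {n} (f ∘ inject₁) + f (fromℕ n)) * ℕ→ℚ 2 + ℕ→ℚ (suc n)
      ≡⟨ cong₂ (λ s t → (s + t) * ℕ→ℚ 2 + ℕ→ℚ (suc n))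
               (sum-cong-≗ {n} (cong ℕ→ℚ ∘ toℕ-inject₁)) (cong ℕ→ℚ (toℕ-fromℕ n)) ⟩
    (Σ + N) * ℕ→ℚ 2 + ℕ→ℚ (suc n)
      ≡⟨ cong (λ s → (Σ + N) * ℕ→ℚ 2 + s) (ℕ→ℚ-suc n) ⟩
    (Σ + N) * ℕ→ℚ 2 + (1ℚ + N)
      ≡⟨ solve 2 (λ Σ N → (Σ :+ N) :* con (ℕ→ℚ 2) :+ (con 1ℚ :+ N)
                       := (Σ :* con (ℕ→ℚ 2) :+ N) :+ (con 1ℚ :+ N :+ N)) refl Σ N ⟩
    (Σ * ℕ→ℚ 2 + N) + (1ℚ + N + N)
      ≡⟨ cong (_+ (1ℚ + N + N)) (∑-toℕ n) ⟩
    N * N + (1ℚ + N + N)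
      ≡⟨ solve 1 (λ N → N :* N :+ (con 1ℚ :+ N :+ N) := (con 1ℚ :+ N) :* (con 1ℚ :+ N)) refl N ⟩
    (1ℚ + N) * (1ℚ + N)
      ≡⟨ cong (λ s → s * s) (ℕ→ℚ-suc n) ⟨
    ℕ→ℚ (suc n) * ℕ→ℚ (suc n) ∎
    where
    f : Fin (suc n) → ℚ
    f i = ℕ→ℚ (toℕ i)
    Σ = sum {n} (λ i → ℕ→ℚ (toℕ i))
    N = ℕ→ℚ n

  offset : (d : ℕ) → Fin (suc d) → ℚ
  offset d i = ℕ→ℚ d * half - ℕ→ℚ (toℕ i)

  ∑-offset≡0 : ∀ d → sum (offset d) ≡ 0ℚ
  ∑-offset≡0 d = begin
    Σo                            ≡⟨ solve 2 (λ o i → o := (o :+ i) :- i) refl Σo Σi ⟩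
    (Σo + Σi) - Σi                ≡⟨ cong₂ _-_ ∑-offset+∑-toℕ ∑-toℕ-closed ⟩
    S * D - (S * S - S) * half    ≡⟨ cong (λ s → s * D - (s * s - s) * half) (ℕ→ℚ-suc d) ⟩
    (1ℚ + N) * (N * half) - ((1ℚ + N) * (1ℚ + N) - (1ℚ + N)) * half
      ≡⟨ solve 1 (λ N → (con 1ℚ :+ N) :* (N :* con half)
                        :- ((con 1ℚ :+ N) :* (con 1ℚ :+ N) :- (con 1ℚ :+ N)) :* con half
                        := con 0ℚ) refl N ⟩
    0ℚ                            ∎
    where
    N = ℕ→ℚ d
    S = ℕ→ℚ (suc d)
    D = N * half
    Σo = sum (offset d)
    Σi = sum {suc d} (λ i → ℕ→ℚ (toℕ i))
    ∑-offset+∑-toℕ : Σo + Σi ≡ S * D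
    ∑-offset+∑-toℕ = begin
      Σo + Σi                                        ≡⟨ ∑-distrib-+ (offset d) (λ i → ℕ→ℚ (toℕ i)) ⟨
      sum (λ i → offset d i + ℕ→ℚ (toℕ i))           ≡⟨ sum-cong-≗ {suc d} (λ i → solve 2 (λ D k → D :- k :+ k := D) refl D (ℕ→ℚ (toℕ i))) ⟩
      sum {suc d} (λ _ → D)                          ≡⟨ sum-const (suc d) D ⟩
      S * D                                          ∎
    ∑-toℕ-closed : Σi ≡ (S * S - S) * half
    ∑-toℕ-closed = begin
      Σi                                   ≡⟨ solve 2 (λ Σ S → Σ := (Σ :* con (ℕ→ℚ 2) :+ S :- S) :* con half) refl Σi S ⟩
      (Σi * ℕ→ℚ 2 + S - S) * half          ≡⟨ cong (λ t → (t - S) * half) (∑-toℕ (suc d)) ⟩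
      (S * S - S) * half                   ∎

  casimir : ℚ → ℚ
  casimir x = x * (x + 1ℚ)

  ∑-casimir-shift : ∀ n x (e : Fin n → ℚ) → sum e ≡ 0ℚ →
                    sum (λ i → casimir (x + e i)) ≡ ℕ→ℚ n * casimir x + sum (casimir ∘ e)
  ∑-casimir-shift n x e ∑e≡0 = begin
    sum (λ i → casimir (x + e i))
      ≡⟨ sum-cong-≗ {n} (λ i → solve 2 (λ x e → (x :+ e) :* ((x :+ e) :+ con 1ℚ)
                                            := x :* (x :+ con 1ℚ) :+ (x :* con (ℕ→ℚ 2) :* e :+ e :* (e :+ con 1ℚ)))
                                       refl x (e i)) ⟩
    sum (λ i → casimir x + (x2 * e i + casimir (e i)))
      ≡⟨ ∑-distrib-+ (λ _ → casimir x) (λ i → x2 * e i + casimir (e i)) ⟩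
    sum {n} (λ _ → casimir x) + sum (λ i → x2 * e i + casimir (e i))
      ≡⟨ cong₂ _+_ (sum-const n (casimir x)) (∑-distrib-+ (λ i → x2 * e i) (casimir ∘ e)) ⟩
    ℕ→ℚ n * casimir x + (sum (λ i → x2 * e i) + sum (casimir ∘ e))
      ≡⟨ cong (λ s → ℕ→ℚ n * casimir x + (s + sum (casimir ∘ e))) (*-distribˡ-sum x2 e) ⟨
    ℕ→ℚ n * casimir x + (x2 * sum e + sum (casimir ∘ e))
      ≡⟨ cong (λ s → ℕ→ℚ n * casimir x + (x2 * s + sum (casimir ∘ e))) ∑e≡0 ⟩
    ℕ→ℚ n * casimir x + (x2 * 0ℚ + sum (casimir ∘ e))
      ≡⟨ cong (ℕ→ℚ n * casimir x +_) (solve 2 (λ a s → a :* con 0ℚ :+ s := s) refl x2 (sum (casimir ∘ e))) ⟩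
    ℕ→ℚ n * casimir x + sum (casimir ∘ e) ∎
    where x2 = x * ℕ→ℚ 2

  trace : ∀ {n} → Matℚ n n → ℚ
  trace X = sum (λ i → X i i)

  ∑casimir-offset : ℕ → ℚ
  ∑casimir-offset d = sum (casimir ∘ offset d)

  ∑θ : ∀ d x → sum {suc d} (λ i → casimir (x + ℕ→ℚ d * half - ℕ→ℚ (toℕ i)))
               ≡ ℕ→ℚ (suc d) * casimir x + ∑casimir-offset d
  ∑θ d x = trans (sum-cong-≗ {suc d} (λ i → cong casimir (ℚP.+-assoc x (ℕ→ℚ d * half) (ℚ.- ℕ→ℚ (toℕ i)))))
                 (∑-casimir-shift (suc d) x (offset d) (∑-offset≡0 d))

  -- `does (m ℕ.≟ n)` computes to `m ℕ.≡ᵇ n`, so rewriting with this lemma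
  -- evaluates the diagonal entries of the matrices in Defs.
  ≡ᵇ-refl : ∀ n → (n ℕ.≡ᵇ n) ≡ true
  ≡ᵇ-refl n = Equivalence.to T-≡ (ℕP.≡⇒≡ᵇ n n refl)

  module TraceFormulas (d : ℕ) (a b c : ℚ) where
    open R d a b c

    idℚ-diag : ∀ (i : Fin (suc d)) → idℚ i i ≡ 1ℚ
    idℚ-diag i rewrite ≡ᵇ-refl (toℕ i) = refl

    Aₘ-diag : ∀ i → Aₘ i i ≡ θ (toℕ i)
    Aₘ-diag i rewrite ≡ᵇ-refl (toℕ i) = refl

    Bₘ-diag : ∀ i → Bₘ i i ≡ θ* (toℕ i)
    Bₘ-diag i rewrite ≡ᵇ-refl (toℕ i) = refl

    trace-Aₘ : trace Aₘ ≡ ℕ→ℚ (suc d) * casimir a + ∑casimir-offset d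
    trace-Aₘ = trans (sum-cong-≗ {suc d} Aₘ-diag) (∑θ d a)

    trace-Bₘ : trace Bₘ ≡ ℕ→ℚ (suc d) * casimir b + ∑casimir-offset d
    trace-Bₘ = trans (sum-cong-≗ {suc d} Bₘ-diag) (∑θ d b)

    trace-ABC : trace Aₘ + trace Bₘ + trace Cₘ ≡ ℕ→ℚ (suc d) * δ
    trace-ABC = begin
      trace Aₘ + trace Bₘ + trace Cₘ               ≡⟨ cong (_+ trace Cₘ) (∑-distrib-+ (λ i → Aₘ i i) (λ i → Bₘ i i)) ⟨
      sum (λ i → Aₘ i i + Bₘ i i) + trace Cₘ       ≡⟨ ∑-distrib-+ (λ i → Aₘ i i + Bₘ i i) (λ i → Cₘ i i) ⟨
      sum (λ i → Aₘ i i + Bₘ i i + Cₘ i i)         ≡⟨ sum-cong-≗ {suc d} A+B+C≡δ ⟩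
      sum {suc d} (λ _ → δ)                        ≡⟨ sum-const (suc d) δ ⟩
      ℕ→ℚ (suc d) * δ                              ∎
      where
      A+B+C≡δ : ∀ i → Aₘ i i + Bₘ i i + Cₘ i i ≡ δ
      A+B+C≡δ i = begin
        Aₘ i i + Bₘ i i + (δ * idℚ i i - Aₘ i i - Bₘ i i)
          ≡⟨ cong (λ t → Aₘ i i + Bₘ i i + (δ * t - Aₘ i i - Bₘ i i)) (idℚ-diag i) ⟩
        Aₘ i i + Bₘ i i + (δ * 1ℚ - Aₘ i i - Bₘ i i)
          ≡⟨ solve 3 (λ x y z → x :+ y :+ (z :* con 1ℚ :- x :- y) := z) refl (Aₘ i i) (Bₘ i i) δ ⟩
        δ ∎

  module _ {d : ℕ} {a b c a′ b′ c′ : ℚ} where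
    private
      module M  = TraceFormulas d a b c
      module M′ = TraceFormulas d a′ b′ c′
      module ρ  = R d a b c
      module ρ′ = R d a′ b′ c′
      S = ℕ→ℚ (suc d)

    equal-traces⇒equal-casimirs :
      trace ρ.Aₘ ≡ trace ρ′.Aₘ → trace ρ.Bₘ ≡ trace ρ′.Bₘ → trace ρ.Cₘ ≡ trace ρ′.Cₘ →
      casimir a ≡ casimir a′ × casimir b ≡ casimir b′ × casimir c ≡ casimir c′
    equal-traces⇒equal-casimirs tA tB tC = ea , eb , ec
      where
      cancel : ∀ {x y} → S * x + ∑casimir-offset d ≡ S * y + ∑casimir-offset d → x ≡ y
      cancel = *-cancelˡ-≡ S (ℕ→ℚ-suc≢0 d) ∘ +-cancelʳ (∑casimir-offset d) _ _
      ea = cancel (trans (sym M.trace-Aₘ) (trans tA M′.trace-Aₘ))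
      eb = cancel (trans (sym M.trace-Bₘ) (trans tB M′.trace-Bₘ))
      eδ : ρ.δ ≡ ρ′.δ
      eδ = *-cancelˡ-≡ S (ℕ→ℚ-suc≢0 d)
             (trans (sym M.trace-ABC) (trans (cong₂ _+_ (cong₂ _+_ tA tB) tC) M′.trace-ABC))
      ec = +-cancelˡ (casimir ρ.D + casimir a′ + casimir b′) (casimir c) (casimir c′)
             (trans (cong₂ (λ x y → casimir ρ.D + x + y + casimir c) (sym ea) (sym eb)) eδ)

  SameInvariants : Params → Params → Set
  SameInvariants (params d a b c) (params d′ a′ b′ c′) =
    d ≡ d′ × casimir a ≡ casimir a′ × casimir b ≡ casimir b′ × casimir c ≡ casimir c′

module Similarity {k ℓ : Level} (F : ℚField k ℓ) where
  open Invariants using (ℕ→ℚ-injective; ℕ→ℚ-suc; trace; equal-traces⇒equal-casimirs; SameInvariants)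

  open ℚField F
  open CommutativeRing ring hiding (ring)
  open IsRingHomomorphism ι-hom
  open OverK F
  module Σ = Algebra.Properties.Semiring.Sum semiring
  open Relation.Binary.Reasoning.Setoid setoid

  traceᴷ : ∀ {n} → Mat n n → Carrier
  traceᴷ X = Σ.sum (λ i → X i i)

  ≈ₘ-refl : ∀ {r s} {X : Mat r s} → X ≈ₘ X
  ≈ₘ-refl _ _ = refl

  ι-injective : ∀ {p q} → ι p ≈ ι q → p ≡ q
  ι-injective {p} {q} ιp≈ιq with p ℚ.≟ q
  ... | yes p≡q = p≡q
  ... | no  p≢q = contradiction 1≈0 (proj₁ isField)
    where
    r = p ℚ.- q
    instance
      r-nonZero : ℚ.NonZero r
      r-nonZero = ℚ.≢-nonZero (p≢q ∘ x∙y⁻¹≈ε⇒x≈y p q)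
    ιr≈0 : ι r ≈ 0#
    ιr≈0 = begin
      ι (p ℚ.+ ℚ.- q)  ≈⟨ +-homo p (ℚ.- q) ⟩
      ι p + ι (ℚ.- q)  ≈⟨ +-cong ιp≈ιq (-‿homo q) ⟩
      ι q - ι q        ≈⟨ -‿inverseʳ (ι q) ⟩
      0#               ∎
    1≈0 : 1# ≈ 0#
    1≈0 = begin
      1#                  ≈⟨ 1#-homo ⟨
      ι 1ℚ                ≡⟨ ≡.cong ι (ℚP.*-inverseʳ r) ⟨
      ι (r ℚ.* 1/ r)      ≈⟨ *-homo r (1/ r) ⟩
      ι r * ι (1/ r)      ≈⟨ *-congʳ ιr≈0 ⟩
      0# * ι (1/ r)       ≈⟨ zeroˡ (ι (1/ r)) ⟩
      0#                  ∎

  ι-sum : ∀ {n} (f : Fin n → ℚ) → ι (sum f) ≈ Σ.sum (ι ∘ f)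
  ι-sum {zero}  f = 0#-homo
  ι-sum {suc n} f = trans (+-homo (f fzero) (sum (f ∘ fsuc))) (+-congˡ (ι-sum (f ∘ fsuc)))

  sumK≡sum : ∀ {n} (f : Fin n → Carrier) → sumK f ≡ Σ.sum f
  sumK≡sum {zero}  f = ≡.refl
  sumK≡sum {suc n} f = ≡.cong (f fzero +_) (sumK≡sum (f ∘ fsuc))

  ·-sum : ∀ {r m s} (X : Mat r m) (Y : Mat m s) i j → (X · Y) i j ≡ Σ.sum (λ k → X i k * Y k j)
  ·-sum X Y i j = sumK≡sum (λ k → X i k * Y k j)

  ·-cong : ∀ {r m s} {X X′ : Mat r m} {Y Y′ : Mat m s} → X ≈ₘ X′ → Y ≈ₘ Y′ → (X · Y) ≈ₘ (X′ · Y′)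
  ·-cong {X = X} {X′} {Y} {Y′} X≈X′ Y≈Y′ i j = begin
    (X · Y) i j                    ≡⟨ ·-sum X Y i j ⟩
    Σ.sum (λ k → X i k * Y k j)    ≈⟨ Σ.sum-cong-≋ (λ k → *-cong (X≈X′ i k) (Y≈Y′ k j)) ⟩
    Σ.sum (λ k → X′ i k * Y′ k j)  ≡⟨ ·-sum X′ Y′ i j ⟨
    (X′ · Y′) i j                  ∎

  ·-assoc : ∀ {r m n s} (X : Mat r m) (Y : Mat m n) (Z : Mat n s) → ((X · Y) · Z) ≈ₘ (X · (Y · Z))
  ·-assoc X Y Z i j = begin
    ((X · Y) · Z) i j                                 ≡⟨ ·-sum (X · Y) Z i j ⟩
    Σ.sum (λ k → (X · Y) i k * Z k j)                 ≡⟨ Σ.sum-cong-≗ (λ k → ≡.cong (_* Z k j) (·-sum X Y i k)) ⟩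
    Σ.sum (λ k → Σ.sum (λ l → X i l * Y l k) * Z k j) ≈⟨ Σ.sum-cong-≋ (λ k → Σ.*-distribʳ-sum (Z k j) (λ l → X i l * Y l k)) ⟩
    Σ.sum (λ k → Σ.sum (λ l → X i l * Y l k * Z k j)) ≈⟨ Σ.∑-comm (λ k l → X i l * Y l k * Z k j) ⟩
    Σ.sum (λ l → Σ.sum (λ k → X i l * Y l k * Z k j)) ≈⟨ Σ.sum-cong-≋ (λ l → Σ.sum-cong-≋ (λ k → *-assoc (X i l) (Y l k) (Z k j))) ⟩
    Σ.sum (λ l → Σ.sum (λ k → X i l * (Y l k * Z k j))) ≈⟨ Σ.sum-cong-≋ (λ l → Σ.*-distribˡ-sum (X i l) (λ k → Y l k * Z k j)) ⟨
    Σ.sum (λ l → X i l * Σ.sum (λ k → Y l k * Z k j)) ≡⟨ Σ.sum-cong-≗ (λ l → ≡.cong (X i l *_) (·-sum Y Z l j)) ⟨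
    Σ.sum (λ l → X i l * (Y · Z) l j)                 ≡⟨ ·-sum X (Y · Z) i j ⟨
    (X · (Y · Z)) i j                                 ∎

  ·-identityˡ : ∀ {n m} (X : Mat n m) → (I · X) ≈ₘ X
  ·-identityˡ {suc n} X fzero j = begin
    1# * X fzero j + sumK (λ k → 0# * X (fsuc k) j)   ≡⟨ ≡.cong (1# * X fzero j +_) (sumK≡sum (λ k → 0# * X (fsuc k) j)) ⟩
    1# * X fzero j + Σ.sum (λ k → 0# * X (fsuc k) j)  ≈⟨ +-cong (*-identityˡ _) (Σ.sum-cong-≋ {n} (λ k → zeroˡ (X (fsuc k) j))) ⟩
    X fzero j + Σ.sum {n} (λ _ → 0#)                   ≈⟨ +-congˡ (Σ.sum-replicate-zero n) ⟩
    X fzero j + 0#                                     ≈⟨ +-identityʳ _ ⟩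
    X fzero j                                          ∎
  ·-identityˡ X (fsuc i) j = trans (+-cong (zeroˡ _) (·-identityˡ (X ∘ fsuc) i j)) (+-identityˡ _)

  trace-cong : ∀ {n} {X Y : Mat n n} → X ≈ₘ Y → traceᴷ X ≈ traceᴷ Y
  trace-cong X≈Y = Σ.sum-cong-≋ (λ i → X≈Y i i)

  trace-ι : ∀ {n} (X : Matℚ n n) → traceᴷ (ιₘ X) ≈ ι (trace X)
  trace-ι X = sym (ι-sum (λ i → X i i))

  trace-I : ∀ n → traceᴷ (I {n}) ≈ ι (ℕ→ℚ n)
  trace-I zero    = sym 0#-homo
  trace-I (suc n) = begin
    1# + traceᴷ (I {n})       ≈⟨ +-cong (sym 1#-homo) (trace-I n) ⟩
    ι 1ℚ + ι (ℕ→ℚ n)          ≈⟨ +-homo 1ℚ (ℕ→ℚ n) ⟨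
    ι (1ℚ ℚ.+ ℕ→ℚ n)          ≡⟨ ≡.cong ι (ℕ→ℚ-suc n) ⟨
    ι (ℕ→ℚ (suc n))           ∎

  trace-comm : ∀ {r s} (X : Mat r s) (Y : Mat s r) → traceᴷ (X · Y) ≈ traceᴷ (Y · X)
  trace-comm X Y = begin
    traceᴷ (X · Y)                             ≡⟨ Σ.sum-cong-≗ (λ i → ·-sum X Y i i) ⟩
    Σ.sum (λ i → Σ.sum (λ k → X i k * Y k i))  ≈⟨ Σ.∑-comm (λ i k → X i k * Y k i) ⟩
    Σ.sum (λ k → Σ.sum (λ i → X i k * Y k i))  ≈⟨ Σ.sum-cong-≋ (λ k → Σ.sum-cong-≋ (λ i → *-comm (X i k) (Y k i))) ⟩
    Σ.sum (λ k → Σ.sum (λ i → Y k i * X i k))  ≡⟨ Σ.sum-cong-≗ (λ k → ·-sum Y X k k) ⟨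
    traceᴷ (Y · X)                             ∎

  module _ {r s} {P : Mat r s} {Q : Mat s r} (PQ≈I : (P · Q) ≈ₘ I) (QP≈I : (Q · P) ≈ₘ I) where

    similar⇒trace≈ : ∀ {X : Mat s s} {Y : Mat r r} → (P · X) ≈ₘ (Y · P) → traceᴷ X ≈ traceᴷ Y
    similar⇒trace≈ {X} {Y} PX≈YP = begin
      traceᴷ X                ≈⟨ trace-cong (·-identityˡ X) ⟨
      traceᴷ (I · X)          ≈⟨ trace-cong (·-cong QP≈I ≈ₘ-refl) ⟨
      traceᴷ ((Q · P) · X)    ≈⟨ trace-cong (·-assoc Q P X) ⟩
      traceᴷ (Q · (P · X))    ≈⟨ trace-comm Q (P · X) ⟩
      traceᴷ ((P · X) · Q)    ≈⟨ trace-cong (·-cong PX≈YP ≈ₘ-refl) ⟩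
      traceᴷ ((Y · P) · Q)    ≈⟨ trace-cong (·-assoc Y P Q) ⟩
      traceᴷ (Y · (P · Q))    ≈⟨ trace-cong (·-cong ≈ₘ-refl PQ≈I) ⟩
      traceᴷ (Y · I)          ≈⟨ trace-comm Y I ⟩
      traceᴷ (I · Y)          ≈⟨ trace-cong (·-identityˡ Y) ⟩
      traceᴷ Y                ∎

    inverse⇒dim≡ : r ≡ s
    inverse⇒dim≡ = ℕ→ℚ-injective (ι-injective (begin
      ι (ℕ→ℚ r)        ≈⟨ trace-I r ⟨
      traceᴷ (I {r})   ≈⟨ trace-cong PQ≈I ⟨
      traceᴷ (P · Q)   ≈⟨ trace-comm P Q ⟩
      traceᴷ (Q · P)   ≈⟨ trace-cong QP≈I ⟩
      traceᴷ (I {s})   ≈⟨ trace-I s ⟩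
      ι (ℕ→ℚ s)        ∎))

    similar⇒trace≡ : ∀ (X : Matℚ s s) (Y : Matℚ r r) → (P · ιₘ X) ≈ₘ (ιₘ Y · P) → trace X ≡ trace Y
    similar⇒trace≡ X Y PX≈YP = ι-injective (begin
      ι (trace X)        ≈⟨ trace-ι X ⟨
      traceᴷ (ιₘ X)      ≈⟨ similar⇒trace≈ PX≈YP ⟩
      traceᴷ (ιₘ Y)      ≈⟨ trace-ι Y ⟩
      ι (trace Y)        ∎)

  isomorphic⇒same-invariants : ∀ p p′ → let open Params in
    Isomorphic (dim p) (pa p) (pb p) (pc p) (dim p′) (pa p′) (pb p′) (pc p′) → SameInvariants p p′
  isomorphic⇒same-invariants (params d a b c) (params d′ a′ b′ c′) iso@(P , Q , PQ≈I , QP≈I , _) =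
    same-invariants (ℕP.suc-injective (≡.sym (inverse⇒dim≡ {P = P} {Q} PQ≈I QP≈I))) iso
    where
    same-invariants : d ≡ d′ → Isomorphic d a b c d′ a′ b′ c′ → SameInvariants (params d a b c) (params d′ a′ b′ c′)
    same-invariants ≡.refl (P , Q , PQ≈I , QP≈I , PA≈AP , PB≈BP , PC≈CP , _) =
      ≡.refl , equal-traces⇒equal-casimirs {d} {a} {b} {c} {a′} {b′} {c′}
                 (tr ρ.Aₘ ρ′.Aₘ PA≈AP) (tr ρ.Bₘ ρ′.Bₘ PB≈BP) (tr ρ.Cₘ ρ′.Cₘ PC≈CP)
      where
      module ρ  = R d a b c
      module ρ′ = R d a′ b′ c′
      tr = similar⇒trace≡ {P = P} {Q} PQ≈I QP≈I

module Labels where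
  open import Data.Rational using (_/_; _+_; _-_; _*_)
  open ≡ using (refl; sym; trans; cong; cong₂; subst; module ≡-Reasoning)
  open +-*-Solver
  open ≡-Reasoning
  open Invariants using (ℕ→ℚ-injective; ℕ→ℚ-homo-+; ℕ→ℚ-homo-*; casimir; SameInvariants)

  square-injective : ∀ {m n} → m ℕ.* m ≡ n ℕ.* n → m ≡ n
  square-injective {m} {n} m²≡n² with ℕP.<-cmp m n
  ... | tri< m<n _ _ = ⊥-elim (ℕP.<-irrefl m²≡n² (ℕP.*-mono-< m<n m<n))
  ... | tri≈ _ m≡n _ = m≡n
  ... | tri> _ _ n<m = ⊥-elim (ℕP.<-irrefl (sym m²≡n²) (ℕP.*-mono-< n<m n<m))

  record HasNorm (x : ℚ) (N : ℕ) : Set where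
    constructor has-norm
    field 4x+2≡N : x * ℕ→ℚ 4 + ℕ→ℚ 2 ≡ ℕ→ℚ N

  equal-casimirs⇒equal-norms : ∀ {x y M N} → casimir x ≡ casimir y → HasNorm x M → HasNorm y N → M ≡ N
  equal-casimirs⇒equal-norms {x} {y} {M} {N} cx≡cy (has-norm x↦M) (has-norm y↦N) =
    square-injective (ℕ→ℚ-injective (begin
      ℕ→ℚ (M ℕ.* M)                         ≡⟨ ℕ→ℚ-homo-* M M ⟩
      ℕ→ℚ M * ℕ→ℚ M                         ≡⟨ cong₂ _*_ x↦M x↦M ⟨
      (x * four + two) * (x * four + two)   ≡⟨ square-casimir x ⟩
      casimir x * ℕ→ℚ 16 + four             ≡⟨ cong (λ t → t * ℕ→ℚ 16 + four) cx≡cy ⟩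
      casimir y * ℕ→ℚ 16 + four             ≡⟨ square-casimir y ⟨
      (y * four + two) * (y * four + two)   ≡⟨ cong₂ _*_ y↦N y↦N ⟩
      ℕ→ℚ N * ℕ→ℚ N                         ≡⟨ ℕ→ℚ-homo-* N N ⟨
      ℕ→ℚ (N ℕ.* N)                         ∎))
    where
    two = ℕ→ℚ 2
    four = ℕ→ℚ 4
    square-casimir : ∀ x → (x * four + two) * (x * four + two) ≡ casimir x * ℕ→ℚ 16 + four
    square-casimir = solve 1 (λ x → (x :* con four :+ con two) :* (x :* con four :+ con two)
                                    := x :* (x :+ con 1ℚ) :* con (ℕ→ℚ 16) :+ con four) refl

  over8-norm : ∀ {y N} → y + ℕ→ℚ 4 ≡ ℕ→ℚ N * ℕ→ℚ 2 → HasNorm (over8 y) N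
  over8-norm {y} {N} y+4≡2N = has-norm (begin
    over8 y * ℕ→ℚ 4 + ℕ→ℚ 2    ≡⟨ solve 1 (λ y → y :* con ((ℤ.+ 1) / 8) :* con (ℕ→ℚ 4) :+ con (ℕ→ℚ 2)
                                               := (y :+ con (ℕ→ℚ 4)) :* con half) refl y ⟩
    (y + ℕ→ℚ 4) * half         ≡⟨ cong (_* half) y+4≡2N ⟩
    ℕ→ℚ N * ℕ→ℚ 2 * half       ≡⟨ solve 1 (λ N → N :* con (ℕ→ℚ 2) :* con half := N) refl (ℕ→ℚ N) ⟩
    ℕ→ℚ N                      ∎)

  family-norm : ∀ m k r j → k ℕ.+ 4 ≡ j ℕ.* 2 ℕ.+ r →
                HasNorm (over8 (ℕ→ℚ (4 ℕ.* m ℕ.+ k) - ℕ→ℚ r)) (j ℕ.+ (m ℕ.+ m))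
  family-norm m k r j k+4≡2j+r = over8-norm {ℕ→ℚ n - R} {N} (begin
    ℕ→ℚ n - R + ℕ→ℚ 4          ≡⟨ solve 3 (λ n r f → n :- r :+ f := n :+ f :- r) refl (ℕ→ℚ n) R (ℕ→ℚ 4) ⟩
    ℕ→ℚ n + ℕ→ℚ 4 - R          ≡⟨ cong (_- R) (ℕ→ℚ-homo-+ n 4) ⟨
    ℕ→ℚ (n ℕ.+ 4) - R          ≡⟨ cong (λ t → ℕ→ℚ t - R) n+4≡2N+r ⟩
    ℕ→ℚ (N ℕ.* 2 ℕ.+ r) - R    ≡⟨ cong (_- R) (trans (ℕ→ℚ-homo-+ (N ℕ.* 2) r) (cong (_+ R) (ℕ→ℚ-homo-* N 2))) ⟩
    ℕ→ℚ N * ℕ→ℚ 2 + R - R      ≡⟨ solve 2 (λ x r → x :+ r :- r := x) refl (ℕ→ℚ N * ℕ→ℚ 2) R ⟩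
    ℕ→ℚ N * ℕ→ℚ 2              ∎)
    where
    n = 4 ℕ.* m ℕ.+ k
    N = j ℕ.+ (m ℕ.+ m)
    R = ℕ→ℚ r
    regroup : ∀ m j r → 4 ℕ.* m ℕ.+ (j ℕ.* 2 ℕ.+ r) ≡ (j ℕ.+ (m ℕ.+ m)) ℕ.* 2 ℕ.+ r
    regroup = solve-∀
    n+4≡2N+r : n ℕ.+ 4 ≡ N ℕ.* 2 ℕ.+ r
    n+4≡2N+r = trans (ℕP.+-assoc (4 ℕ.* m) k 4) (trans (cong (4 ℕ.* m ℕ.+_) k+4≡2j+r) (regroup m j r))

  data Kind : Set where
    quarter low mid high : Kind

  norm : ℕ → Kind → ℕ
  norm m quarter = 1
  norm m low     = m ℕ.+ m
  norm m mid     = 2 ℕ.+ (m ℕ.+ m)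
  norm m high    = 4 ℕ.+ (m ℕ.+ m)

  m+m≢1 : ∀ m → m ℕ.+ m ≢ 1
  m+m≢1 (suc m) m+m≡1 = ℕP.m+1+n≢0 m (ℕP.suc-injective m+m≡1)

  norm-injective : ∀ m {k k′} → norm m k ≡ norm m k′ → k ≡ k′
  norm-injective m {quarter} {quarter} _ = refl
  norm-injective m {low}     {low}     _ = refl
  norm-injective m {mid}     {mid}     _ = refl
  norm-injective m {high}    {high}    _ = refl
  norm-injective m {quarter} {low}     e = ⊥-elim (m+m≢1 m (sym e))
  norm-injective m {low}     {quarter} e = ⊥-elim (m+m≢1 m e)
  norm-injective m {low}     {mid}     e = ⊥-elim (ℕP.m≢1+n+m (m ℕ.+ m) {1} e)
  norm-injective m {mid}     {low}     e = ⊥-elim (ℕP.m≢1+n+m (m ℕ.+ m) {1} (sym e))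
  norm-injective m {low}     {high}    e = ⊥-elim (ℕP.m≢1+n+m (m ℕ.+ m) {3} e)
  norm-injective m {high}    {low}     e = ⊥-elim (ℕP.m≢1+n+m (m ℕ.+ m) {3} (sym e))
  norm-injective m {mid}     {high}    e = ⊥-elim (ℕP.m≢1+n+m (m ℕ.+ m) {1} (ℕP.suc-injective (ℕP.suc-injective e)))
  norm-injective m {high}    {mid}     e = ⊥-elim (ℕP.m≢1+n+m (m ℕ.+ m) {1} (ℕP.suc-injective (ℕP.suc-injective (sym e))))
  norm-injective m {quarter} {mid}     ()
  norm-injective m {quarter} {high}    ()
  norm-injective m {mid}     {quarter} ()
  norm-injective m {high}    {quarter} ()

  Kinds : Set
  Kinds = Kind × Kind × Kind

  placeKinds : Pos → Kind → Kind → Kinds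
  placeKinds first  x y = x , y , y
  placeKinds second x y = y , x , y
  placeKinds third  x y = y , y , x

  kinds : Label → Kinds
  kinds (fam1 m)   = quarter , quarter , quarter
  kinds (fam2 k m) = placeKinds k low mid
  kinds (fam3 m)   = high , high , high
  kinds (fam4 k m) = placeKinds k high mid
  kinds (fam5 m)   = low , low , low

  fromKinds : ℕ → Kinds → Maybe Label
  fromKinds m (quarter , quarter , quarter) = just (fam1 m)
  fromKinds m (low     , mid     , mid)     = just (fam2 first m)
  fromKinds m (mid     , low     , mid)     = just (fam2 second m)
  fromKinds m (mid     , mid     , low)     = just (fam2 third m)
  fromKinds m (high    , high    , high)    = just (fam3 m)
  fromKinds m (high    , mid     , mid)     = just (fam4 first m)
  fromKinds m (mid     , high    , mid)     = just (fam4 second m)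
  fromKinds m (mid     , mid     , high)    = just (fam4 third m)
  fromKinds m (low     , low     , low)     = just (fam5 m)
  fromKinds m _                             = nothing

  dim : Label → ℕ
  dim l = Params.dim (paramsOf l)

  parameters : Label → ℚ × ℚ × ℚ
  parameters l = Params.pa (paramsOf l) , Params.pb (paramsOf l) , Params.pc (paramsOf l)

  fromKinds-kinds : ∀ l → fromKinds (dim l) (kinds l) ≡ just l
  fromKinds-kinds (fam1 m)        = refl
  fromKinds-kinds (fam2 first m)  = refl
  fromKinds-kinds (fam2 second m) = refl
  fromKinds-kinds (fam2 third m)  = refl
  fromKinds-kinds (fam3 m)        = refl
  fromKinds-kinds (fam4 first m)  = refl
  fromKinds-kinds (fam4 second m) = refl
  fromKinds-kinds (fam4 third m)  = refl
  fromKinds-kinds (fam5 m)        = refl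

  HasNorms : ℕ → ℚ × ℚ × ℚ → Kinds → Set
  HasNorms m (a , b , c) (ka , kb , kc) = HasNorm a (norm m ka) × HasNorm b (norm m kb) × HasNorm c (norm m kc)

  place-norms : ∀ k {m x y kx ky} → HasNorm x (norm m kx) → HasNorm y (norm m ky) →
                HasNorms m (place k x y) (placeKinds k kx ky)
  place-norms first  x↦ y↦ = x↦ , y↦ , y↦
  place-norms second x↦ y↦ = y↦ , x↦ , y↦
  place-norms third  x↦ y↦ = y↦ , y↦ , x↦

  label-norms : ∀ l → HasNorms (dim l) (parameters l) (kinds l)
  label-norms (fam1 m)   = has-norm refl , has-norm refl , has-norm refl
  label-norms (fam2 k m) = place-norms k (family-norm m 2 6 0 refl) (family-norm m 2 2 2 refl)
  label-norms (fam3 m)   = let x↦ = family-norm m 6 2 4 refl in x↦ , x↦ , x↦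
  -- n/8 and 4m are (n - 0)/8 and 4m + 0 only up to propositional equality.
  label-norms (fam4 k m) = place-norms k (subst (λ y → HasNorm (over8 y) (norm m high))
                                                (ℚP.+-identityʳ (ℕ→ℚ (4 ℕ.* m ℕ.+ 4)))
                                                (family-norm m 4 0 4 refl))
                                         (family-norm m 4 4 2 refl)
  label-norms (fam5 m)   = x↦ , x↦ , x↦
    where
    x↦ = subst (λ n → HasNorm (over8 (ℕ→ℚ n - ℕ→ℚ 4)) (norm m low))
               (ℕP.+-identityʳ (4 ℕ.* m))
               (family-norm m 0 4 0 refl)

  kind-determined : ∀ {m m′ x x′ k k′} → m ≡ m′ → casimir x ≡ casimir x′ →
                    HasNorm x (norm m k) → HasNorm x′ (norm m′ k′) → k ≡ k′
  kind-determined {m} refl cx≡cx′ x↦ x′↦ = norm-injective m (equal-casimirs⇒equal-norms cx≡cx′ x↦ x′↦)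

  label-determined : ∀ l l′ → SameInvariants (paramsOf l) (paramsOf l′) → l ≡ l′
  label-determined l l′ (d≡d′ , ca , cb , cc) = just-injective (begin
    just l                          ≡⟨ fromKinds-kinds l ⟨
    fromKinds (dim l) (kinds l)     ≡⟨ cong₂ fromKinds d≡d′ kinds≡ ⟩
    fromKinds (dim l′) (kinds l′)   ≡⟨ fromKinds-kinds l′ ⟩
    just l′                         ∎)
    where
    kinds≡ : kinds l ≡ kinds l′
    kinds≡ =
      let (a↦ , b↦ , c↦) = label-norms l
          (a′↦ , b′↦ , c′↦) = label-norms l′
      in cong₂ _,_ (kind-determined d≡d′ ca a↦ a′↦)
                   (cong₂ _,_ (kind-determined d≡d′ cb b↦ b′↦) (kind-determined d≡d′ cc c↦ c′↦))

proposition7p7 : ∀ {c ℓ : Level} (F : ℚField c ℓ) (l l′ : Label) →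
    l ≢ l′ → ¬ LabelIso F l l′
proposition7p7 F l l′ l≢l′ iso =
  l≢l′ (Labels.label-determined l l′ (Similarity.isomorphic⇒same-invariants F (paramsOf l) (paramsOf l′) iso))
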